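{- There is a function $f:\mathbb F_2^n\to[-1,1]$ of Fourier degree one for which $\mathsf r(f,\delta)\ge n/2$ for all $\delta<1/n$.
   Context: For $f:\mathbb{F}_2^n\to\mathbb{R}$, $\hat f(\gamma)=\mathbb{E}_{x}[f(x)(-1)^{\langle\gamma,x\rangle}]$ and the Fourier degree is $\max\{\|\gamma\|_1:\hat f(\gamma)\ne0\}$ ($\|\gamma\|_1$ Hamming weight). For an affine subspace $\mathcal U=\alpha+\mathcal V$, $f_{\mathcal U}:\mathcal V\to\mathbb R$ is $f_{\mathcal U}(x)=f(x+\alpha)$; choosing a subspace $\mathcal W$ with $\mathcal W\cap\mathcal V^\perp=\{0\}$, $\mathcal W+\mathcal V^\perp=\mathbb F_2^n$, $f_{\mathcal U}$ is $\delta$-regular if $|\mathbb E_{x\in\mathcal V}[f(x+\alpha)(-1)^{\langle\gamma,x\rangle}]|\le\delta$ for all nonzero $\gamma\in\mathcal W$ (independent of these choices). $\mathsf r(f,\delta)$ is the minimum of $n-\dim(\mathcal U)$ over affine subspaces $\mathcal U$ with $f_{\mathcal U}$ $\delta$-regular.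
   Formalization: The threshold δ ranges over the rationals, and the function f takes rational values in [-1,1]. -}

module Defs where

open import Data.Bool using (Bool; true; false; _xor_; _∧_; if_then_else_)
open import Data.Nat as ℕ using (ℕ; zero; suc)
open import Data.Integer using (+_)
open import Data.Vec using (Vec; []; _∷_; zipWith; replicate)
open import Data.Rational as ℚ using (ℚ; 0ℚ; 1ℚ; ½; _+_; _*_; -_; ∣_∣; _/_)
open import Data.Product using (Σ; _×_; ∃)
open import Relation.Binary.PropositionalEquality using (_≡_; _≢_)
open import Relation.Nullary using (¬_)

F2 : ℕ → Set
F2 n = Vec Bool n

_⊕_ : ∀ {n} → F2 n → F2 n → F2 n
_⊕_ = zipWith _xor_

0v : (n : ℕ) → F2 n
0v n = replicate n false

dot : ∀ {n} → F2 n → F2 n → Bool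
dot [] [] = false
dot (a ∷ as) (b ∷ bs) = (a ∧ b) xor dot as bs

weight : ∀ {n} → F2 n → ℕ
weight [] = 0
weight (true ∷ v) = suc (weight v)
weight (false ∷ v) = weight v

sgn : Bool → ℚ
sgn false = 1ℚ
sgn true = - 1ℚ

sumAll : (k : ℕ) → (F2 k → ℚ) → ℚ
sumAll zero g = g []
sumAll (suc k) g = sumAll k (λ v → g (false ∷ v)) + sumAll k (λ v → g (true ∷ v))

inv2^ : ℕ → ℚ
inv2^ zero = 1ℚ
inv2^ (suc k) = ½ * inv2^ k

avg : (k : ℕ) → (F2 k → ℚ) → ℚ
avg k g = inv2^ k * sumAll k g

fourier : ∀ {n} → (F2 n → ℚ) → F2 n → ℚ
fourier {n} f γ = avg n (λ x → f x * sgn (dot γ x))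

HasFourierDegree : ∀ {n} → (F2 n → ℚ) → ℕ → Set
HasFourierDegree {n} f d =
  (∀ (γ : F2 n) → fourier f γ ≢ 0ℚ → weight γ ℕ.≤ d)
  × (Σ (F2 n) λ γ → (fourier f γ ≢ 0ℚ) × (weight γ ≡ d))

linComb : ∀ {n k} → Vec (F2 n) k → F2 k → F2 n
linComb {n} [] [] = 0v n
linComb (v ∷ vs) (c ∷ cs) = if c then v ⊕ linComb vs cs else linComb vs cs

LinIndep : ∀ {n k} → Vec (F2 n) k → Set
LinIndep {n} {k} B = ∀ (c : F2 k) → linComb B c ≡ 0v n → c ≡ 0v k

record AffineSubspace (n : ℕ) : Set where
  field
    dim    : ℕ
    basis  : Vec (F2 n) dim
    indep  : LinIndep basis
    offset : F2 n

open AffineSubspace public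

codim : ∀ {n} → AffineSubspace n → ℕ
codim {n} U = n ℕ.∸ dim U

InPerp : ∀ {n} → AffineSubspace n → F2 n → Set
InPerp U γ = ∀ (c : F2 (dim U)) → dot γ (linComb (basis U) c) ≡ false

-- 𝔼_{x∈𝒱}[f(x+α)(-1)^⟨γ,x⟩], x = Σ cᵢ vᵢ ranging over 𝒱 bijectively
restrCoeff : ∀ {n} → (F2 n → ℚ) → AffineSubspace n → F2 n → ℚ
restrCoeff f U γ =
  avg (dim U) (λ c → f (linComb (basis U) c ⊕ offset U) * sgn (dot γ (linComb (basis U) c)))

-- f_𝒰 is δ-regular: the bound holds for every γ that induces a nontrivial
-- character on 𝒱 (i.e. γ ∉ 𝒱^⊥; equivalently every nonzero γ in any complement 𝒲)
IsRegular : ∀ {n} → (F2 n → ℚ) → AffineSubspace n → ℚ → Set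
IsRegular f U δ = ∀ γ → ¬ InPerp U γ → ∣ restrCoeff f U γ ∣ ℚ.≤ δ

RegCodimAtLeastHalf : (n : ℕ) → (F2 n → ℚ) → ℚ → Set
RegCodimAtLeastHalf n f δ = ∀ (U : AffineSubspace n) → IsRegular f U δ → n ℕ.≤ 2 ℕ.* codim U

-- The example is f(x) = (1/n) Σᵢ (-1)^{xᵢ}. Restricted to α + span(b₁,…,b_d) it becomes
-- (1/n) Σᵢ (-1)^{αᵢ} χ_{rᵢ}, where rᵢ = (⟨eᵢ,b₁⟩,…,⟨eᵢ,b_d⟩) is the i-th row of the matrix with
-- columns bⱼ. If a nonzero row value occurs exactly once, the restriction has a Fourier
-- coefficient of size 1/n > δ, so on a δ-regular restriction every nonzero row value is repeated
-- and there are at most n/2 distinct ones. They span F₂^d because the bⱼ are independent,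
-- hence d ≤ n/2.
module Submission where

open import Defs
open import Data.Nat as ℕ using (ℕ; NonZero)
open import Data.Integer using (+_)
open import Data.Rational as ℚ using (ℚ; 1ℚ; -_; _/_)
open import Data.Product using (Σ; _×_)

open import Algebra.Bundles using (CommutativeRing)
open import Data.Bool as Bool using (Bool; true; false; not; _∧_; _xor_; if_then_else_)
open import Data.Bool.Properties
  using (∧-comm; ∧-identityʳ; ∧-zeroʳ; ∧-distribˡ-xor; xor-comm; xor-same; xor-identityʳ; xor-∧-commutativeRing)
open import Algebra.Properties.CommutativeSemigroup
  (CommutativeRing.+-commutativeSemigroup xor-∧-commutativeRing) using (interchange)
open import Data.Empty using (⊥-elim)
import Data.Integer as ℤ
import Data.Integer.Properties as ℤₚ
open import Data.List as List using (List; []; _∷_; length; filter)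
open import Data.List.Properties using (length-map; map-∘; map-id)
open import Data.List.Membership.Propositional using (_∈_; _∉_)
open import Data.List.Membership.Propositional.Properties using (∈-map⁺; ∈-map⁻; ∈-filter⁺; ∈-filter⁻)
open import Data.List.Relation.Unary.Any using (here; there)
open import Data.Nat using (zero; suc; _≤_; _<_; z≤n; s≤s; s<s⁻¹; _∸_)
open import Data.Nat.Properties
  using (≤-refl; ≤-reflexive; ≤-trans; <⇒≤; +-suc; ≰⇒>; n≢0⇒n>0; *-suc; m≤n⇒m≤1+n; +-monoʳ-≤; +-monoˡ-≤; *-monoʳ-≤;
         m+n≤o⇒m≤o∸n; m≤n+m∸n; suc-injective; module ≤-Reasoning)
  renaming (+-identityʳ to +-identityʳℕ)
open import Data.Product using (∃; _,_; proj₁; proj₂)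
open import Data.Rational using (0ℚ; _+_; _*_; ∣_∣; 1/_; NonNegative)
open import Data.Rational.Literals using (fromℤ)
open import Data.Rational.Properties
  using (+-identityˡ; +-identityʳ; +-inverseʳ; *-identityˡ; *-identityʳ; *-zeroˡ; *-zeroʳ; *-assoc;
         *-distribˡ-+; *-distribʳ-+; neg-distrib-+; neg-distribʳ-*; *-inverseˡ; /-cong; ↥p/↧p≡p;
         ∣p*q∣≡∣p∣*∣q∣; 0≤p⇒∣p∣≡p; <⇒≢; <-irrefl; ≤-<-trans; +-mono-≤; *-monoˡ-≤-nonNeg;
         nonNegative⁻¹; positive⁻¹; normalize-nonNeg; normalize-pos; ≤ᵇ⇒≤)
import Data.Rational.Properties as ℚₚ
open import Data.Rational.Solver using (module +-*-Solver)
open import Data.Sum using (_⊎_; inj₁; inj₂; [_,_]′)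
import Data.Sum as Sum
open import Data.Vec as Vec using (Vec; []; _∷_; head)
open import Data.Vec.Properties using (≡-dec; ∷-injectiveˡ; ∷-injectiveʳ)
open import Function using (_∘_; case_of_)
open import Relation.Binary.Definitions using (DecidableEquality)
open import Relation.Binary.PropositionalEquality
  using (_≡_; _≢_; refl; sym; trans; cong; cong₂; subst; ≢-sym; module ≡-Reasoning)
open import Relation.Nullary using (¬_; yes; no; ¬?)

open +-*-Solver

_≟v_ : ∀ {n} → DecidableEquality (F2 n)
_≟v_ = ≡-dec Bool._≟_

dot-comm : ∀ {n} (x y : F2 n) → dot x y ≡ dot y x
dot-comm [] [] = refl
dot-comm (a ∷ x) (b ∷ y) = cong₂ _xor_ (∧-comm a b) (dot-comm x y)

dot-0vˡ : ∀ {n} (x : F2 n) → dot (0v n) x ≡ false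
dot-0vˡ [] = refl
dot-0vˡ (_ ∷ x) = dot-0vˡ x

dot-0vʳ : ∀ {n} (x : F2 n) → dot x (0v n) ≡ false
dot-0vʳ x = trans (dot-comm x _) (dot-0vˡ x)

dot-⊕ʳ : ∀ {n} (γ x y : F2 n) → dot γ (x ⊕ y) ≡ dot γ x xor dot γ y
dot-⊕ʳ [] [] [] = refl
dot-⊕ʳ (a ∷ γ) (b ∷ x) (c ∷ y) = begin
  (a ∧ (b xor c)) xor dot γ (x ⊕ y)                ≡⟨ cong₂ _xor_ (∧-distribˡ-xor a b c) (dot-⊕ʳ γ x y) ⟩
  ((a ∧ b) xor (a ∧ c)) xor (dot γ x xor dot γ y)  ≡⟨ interchange (a ∧ b) (a ∧ c) (dot γ x) (dot γ y) ⟩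
  ((a ∧ b) xor dot γ x) xor ((a ∧ c) xor dot γ y)  ∎
  where open ≡-Reasoning

dot-⊕ˡ : ∀ {n} (x y γ : F2 n) → dot (x ⊕ y) γ ≡ dot x γ xor dot y γ
dot-⊕ˡ x y γ =
  trans (dot-comm (x ⊕ y) γ) (trans (dot-⊕ʳ γ x y) (cong₂ _xor_ (dot-comm γ x) (dot-comm γ y)))

⊕-self : ∀ {n} (x : F2 n) → x ⊕ x ≡ 0v n
⊕-self [] = refl
⊕-self (a ∷ x) = cong₂ _∷_ (xor-same a) (⊕-self x)

xor≡false⇒≡ : ∀ a b → a xor b ≡ false → a ≡ b
xor≡false⇒≡ false false _ = refl
xor≡false⇒≡ true true _ = refl

⊕≡0v⇒≡ : ∀ {n} (x y : F2 n) → x ⊕ y ≡ 0v n → x ≡ y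
⊕≡0v⇒≡ [] [] _ = refl
⊕≡0v⇒≡ (a ∷ x) (b ∷ y) eq =
  cong₂ _∷_ (xor≡false⇒≡ a b (∷-injectiveˡ eq)) (⊕≡0v⇒≡ x y (∷-injectiveʳ eq))

weight-0v : ∀ n → weight (0v n) ≡ 0
weight-0v zero = refl
weight-0v (suc n) = weight-0v n

unitVectors : (n : ℕ) → List (F2 n)
unitVectors zero = []
unitVectors (suc n) = (true ∷ 0v n) ∷ List.map (false ∷_) (unitVectors n)

length-unitVectors : ∀ n → length (unitVectors n) ≡ n
length-unitVectors zero = refl
length-unitVectors (suc n) = cong suc (trans (length-map _ (unitVectors n)) (length-unitVectors n))

weight-unitVectors : ∀ {n e} → e ∈ unitVectors n → weight e ≡ 1
weight-unitVectors {suc n} (here refl) = cong suc (weight-0v n)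
weight-unitVectors {suc n} (there e∈) with ∈-map⁻ (false ∷_) e∈
... | _ , u∈ , refl = weight-unitVectors u∈

unitVectors-separate : ∀ {n} (y : F2 n) → (∀ {e} → e ∈ unitVectors n → dot e y ≡ false) → y ≡ 0v n
unitVectors-separate [] _ = refl
unitVectors-separate {suc n} (b ∷ y) e⊥y =
  cong₂ _∷_ b≡false (unitVectors-separate y (λ e∈ → e⊥y (there (∈-map⁺ (false ∷_) e∈))))
  where
  b≡false : b ≡ false
  b≡false = trans (sym (trans (cong (b xor_) (dot-0vˡ y)) (xor-identityʳ b))) (e⊥y (here refl))

pullback : ∀ {n d} → Vec (F2 n) d → F2 n → F2 d
pullback B γ = Vec.map (dot γ) B

dot-linComb : ∀ {n d} (B : Vec (F2 n) d) γ c → dot γ (linComb B c) ≡ dot (pullback B γ) c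
dot-linComb [] γ [] = dot-0vʳ γ
dot-linComb (b ∷ B) γ (true ∷ c) = begin
  dot γ (b ⊕ linComb B c)                    ≡⟨ dot-⊕ʳ γ b (linComb B c) ⟩
  dot γ b xor dot γ (linComb B c)            ≡⟨ cong₂ _xor_ (sym (∧-identityʳ (dot γ b))) (dot-linComb B γ c) ⟩
  (dot γ b ∧ true) xor dot (pullback B γ) c  ∎
  where open ≡-Reasoning
dot-linComb (b ∷ B) γ (false ∷ c) =
  trans (dot-linComb B γ c) (cong (_xor dot (pullback B γ) c) (sym (∧-zeroʳ (dot γ b))))

pullback≢0v⇒¬InPerp : ∀ {n} (U : AffineSubspace n) γ → pullback (basis U) γ ≢ 0v (dim U) → ¬ InPerp U γ
pullback≢0v⇒¬InPerp U γ γ≢0 γ⊥ = γ≢0 (unitVectors-separate (pullback (basis U) γ) λ {e} _ →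
  trans (dot-comm e _) (trans (sym (dot-linComb (basis U) γ e)) (γ⊥ e)))

LinIndep⇒rows-separate : ∀ {n d} {B : Vec (F2 n) d} → LinIndep B → ∀ c →
  (∀ {e} → e ∈ unitVectors n → dot (pullback B e) c ≡ false) → c ≡ 0v d
LinIndep⇒rows-separate {B = B} indep c rows⊥c =
  indep c (unitVectors-separate (linComb B c) λ {e} e∈ → trans (dot-linComb B e c) (rows⊥c e∈))

data Pivot {d} (L : List (F2 (suc d))) : Set where
  noPivot : (∀ {w} → w ∈ L → head w ≡ false) → Pivot L
  pivotAt : ∀ w₀ L₀ → length L ≡ suc (length L₀) → (∀ {w} → w ∈ L → w ≡ true ∷ w₀ ⊎ w ∈ L₀) → Pivot L

pivot? : ∀ {d} (L : List (F2 (suc d))) → Pivot L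
pivot? [] = noPivot λ ()
pivot? ((true ∷ w) ∷ L) = pivotAt w L refl λ { (here refl) → inj₁ refl ; (there w∈) → inj₂ w∈ }
pivot? ((false ∷ w) ∷ L) with pivot? L
... | noPivot heads = noPivot λ { (here refl) → refl ; (there w∈) → heads w∈ }
... | pivotAt w₀ L₀ eq split = pivotAt w₀ ((false ∷ w) ∷ L₀) (cong suc eq)
  λ { (here refl) → inj₂ (here refl) ; (there w∈) → Sum.map₂ there (split w∈) }

clearPivot : ∀ {d} → F2 d → F2 (suc d) → F2 d
clearPivot w₀ (a ∷ w) = if a then w ⊕ w₀ else w

-- Gaussian elimination: clear the first coordinate using a pivot row, recurse, and then choose
-- the first entry of c to make it orthogonal to the pivot.
∃-orthogonal : ∀ d (L : List (F2 d)) → length L < d →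
  ∃ λ c → c ≢ 0v d × (∀ {w} → w ∈ L → dot w c ≡ false)
∃-orthogonal (suc d) L |L|<d with pivot? L
... | noPivot heads = true ∷ 0v d , (λ ()) , λ {w} w∈ → e₁-orth w (heads w∈)
  where
  e₁-orth : ∀ w → head w ≡ false → dot w (true ∷ 0v d) ≡ false
  e₁-orth (false ∷ w) _ = dot-0vʳ w
... | pivotAt w₀ L₀ eq split
  with ∃-orthogonal d (List.map (clearPivot w₀) L₀)
         (subst (_< d) (sym (length-map _ L₀)) (s<s⁻¹ (subst (_< suc d) eq |L|<d)))
... | c , c≢0 , orth = dot w₀ c ∷ c , c≢0 ∘ ∷-injectiveʳ , λ {w} w∈ →
  [ (λ { refl → xor-same (dot w₀ c) }) , (λ w∈L₀ → lift w (orth (∈-map⁺ _ w∈L₀))) ]′ (split w∈)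
  where
  lift : ∀ w → dot (clearPivot w₀ w) c ≡ false → dot w (dot w₀ c ∷ c) ≡ false
  lift (false ∷ u) u⊥c = u⊥c
  lift (true ∷ u) u+w₀⊥c = trans (xor-comm (dot w₀ c) (dot u c)) (trans (sym (dot-⊕ˡ u w₀ c)) u+w₀⊥c)

dim≤length : ∀ {d} (L : List (F2 d)) → (∀ c → (∀ {w} → w ∈ L → dot w c ≡ false) → c ≡ 0v d) →
  d ≤ length L
dim≤length {d} L L⊥≡0 with d ℕ.≤? length L
... | yes d≤ = d≤
... | no d≰ with ∃-orthogonal d L (≰⇒> d≰)
... | c , c≢0 , orth = ⊥-elim (c≢0 (L⊥≡0 c orth))

module Occurrences {A : Set} (_≟_ : DecidableEquality A) where

  count : A → List A → ℕ
  count v [] = 0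
  count v (x ∷ xs) with x ≟ v
  ... | yes _ = suc (count v xs)
  ... | no _ = count v xs

  remove : A → List A → List A
  remove r = filter (λ x → ¬? (x ≟ r))

  count-≡ : ∀ x xs → count x (x ∷ xs) ≡ suc (count x xs)
  count-≡ x xs with x ≟ x
  ... | yes _ = refl
  ... | no x≢x = ⊥-elim (x≢x refl)

  count-≢ : ∀ {x v} xs → x ≢ v → count v (x ∷ xs) ≡ count v xs
  count-≢ {x} {v} xs x≢v with x ≟ v
  ... | yes x≡v = ⊥-elim (x≢v x≡v)
  ... | no _ = refl

  count≡suc⇒∈ : ∀ v xs {k} → count v xs ≡ suc k → v ∈ xs
  count≡suc⇒∈ v (x ∷ xs) eq with x ≟ v
  ... | yes refl = here refl
  ... | no _ = there (count≡suc⇒∈ v xs eq)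

  count≡0⇒∉ : ∀ v xs → count v xs ≡ 0 → v ∉ xs
  count≡0⇒∉ v (x ∷ xs) eq v∈ with x ≟ v | v∈
  ... | yes _ | _ = case eq of λ ()
  ... | no x≢v | here refl = x≢v refl
  ... | no _ | there v∈xs = count≡0⇒∉ v xs eq v∈xs

  length-remove : ∀ r xs → length xs ≡ count r xs ℕ.+ length (remove r xs)
  length-remove r [] = refl
  length-remove r (x ∷ xs) with x ≟ r
  ... | yes _ = cong suc (length-remove r xs)
  ... | no _ = trans (cong suc (length-remove r xs)) (sym (+-suc (count r xs) _))

  count-remove : ∀ {v r} xs → v ≢ r → count v (remove r xs) ≡ count v xs
  count-remove [] _ = refl
  count-remove {v} {r} (x ∷ xs) v≢r with x ≟ r
  ... | yes refl = trans (count-remove xs v≢r) (sym (count-≢ xs (v≢r ∘ sym)))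
  ... | no _ with x ≟ v
  ...   | yes _ = cong suc (count-remove xs v≢r)
  ...   | no _ = count-remove xs v≢r

  remove-< : ∀ r xs → count r xs ≢ 0 → length (remove r xs) < length xs
  remove-< r xs r∈xs = ≤-trans (+-monoˡ-≤ (length (remove r xs)) (n≢0⇒n>0 r∈xs))
                               (≤-reflexive (sym (length-remove r xs)))

  NoSingletonsExcept : A → List A → Set
  NoSingletonsExcept z R = ∀ v → count v R ≡ 1 → v ≡ z

  noSingletons-∷ : ∀ {z r} rest → r ≡ z → NoSingletonsExcept z (r ∷ rest) → NoSingletonsExcept z rest
  noSingletons-∷ {r = r} rest r≡z once⇒z v once with v ≟ r
  ... | yes refl = r≡z
  ... | no v≢r = once⇒z v (trans (count-≢ rest (v≢r ∘ sym)) once)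

  noSingletons-remove : ∀ {z r} rest → NoSingletonsExcept z (r ∷ rest) → NoSingletonsExcept z (remove r rest)
  noSingletons-remove {r = r} rest once⇒z v once =
    once⇒z v (trans (count-≢ rest (v≢r ∘ sym)) (trans (sym (count-remove rest v≢r)) once))
    where
    v≢r : v ≢ r
    v≢r = proj₂ (∈-filter⁻ (λ x → ¬? (x ≟ r)) {xs = rest} (count≡suc⇒∈ v (remove r rest) once))

  record HalfCover (z : A) (R : List A) : Set where
    field
      elems  : List A
      small  : 2 ℕ.* length elems ≤ length R
      covers : ∀ {v} → v ∈ R → v ≡ z ⊎ v ∈ elems

  -- Induction on length R (k is fuel): a head r ≢ z occurs at least twice, so removing all
  -- copies of r shortens R by at least 2 while r alone joins the cover.
  halfCover′ : ∀ {z} k R → length R ≤ k → NoSingletonsExcept z R → HalfCover z R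
  halfCover′ _ [] _ _ = record { elems = [] ; small = z≤n ; covers = λ () }
  halfCover′ {z} (suc k) (r ∷ rest) (s≤s |rest|≤k) once⇒z with r ≟ z
  ... | yes r≡z = record
    { elems = elems
    ; small = m≤n⇒m≤1+n small
    ; covers = λ { (here refl) → inj₁ r≡z ; (there v∈) → covers v∈ }
    }
    where open HalfCover (halfCover′ k rest |rest|≤k (noSingletons-∷ rest r≡z once⇒z))
  ... | no r≢z = record
    { elems = r ∷ elems
    ; small = small′
    ; covers = λ { (here refl) → inj₂ (here refl) ; (there v∈) → covers′ v∈ }
    }
    where
    rest′ : List A
    rest′ = remove r rest
    |rest′|<|rest| : length rest′ < length rest
    |rest′|<|rest| = remove-< r rest λ c≡0 → r≢z (once⇒z r (trans (count-≡ r rest) (cong suc c≡0)))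
    open HalfCover (halfCover′ k rest′ (≤-trans (<⇒≤ |rest′|<|rest|) |rest|≤k) (noSingletons-remove rest once⇒z))
    small′ : 2 ℕ.* suc (length elems) ≤ suc (length rest)
    small′ = begin
      2 ℕ.* suc (length elems)  ≡⟨ *-suc 2 (length elems) ⟩
      2 ℕ.+ 2 ℕ.* length elems  ≤⟨ +-monoʳ-≤ 2 small ⟩
      2 ℕ.+ length rest′        ≤⟨ s≤s |rest′|<|rest| ⟩
      suc (length rest)         ∎
      where open ≤-Reasoning
    covers′ : ∀ {v} → v ∈ rest → v ≡ z ⊎ v ∈ r ∷ elems
    covers′ {v} v∈ with v ≟ r
    ... | yes refl = inj₂ (here refl)
    ... | no v≢r = Sum.map₂ there (covers (∈-filter⁺ (λ x → ¬? (x ≟ r)) v∈ v≢r))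

  halfCover : ∀ {z} R → NoSingletonsExcept z R → HalfCover z R
  halfCover R = halfCover′ (length R) R ≤-refl

χ : ∀ {n} → F2 n → F2 n → ℚ
χ γ x = sgn (dot γ x)

sgn-xor : ∀ a b → sgn (a xor b) ≡ sgn a * sgn b
sgn-xor false false = refl
sgn-xor false true = refl
sgn-xor true false = refl
sgn-xor true true = refl

sgn-not : ∀ a → sgn (not a) ≡ - sgn a
sgn-not false = refl
sgn-not true = refl

∣sgn∣ : ∀ a → ∣ sgn a ∣ ≡ 1ℚ
∣sgn∣ false = refl
∣sgn∣ true = refl

sgn-bounded : ∀ a → (- 1ℚ ℚ.≤ sgn a) × (sgn a ℚ.≤ 1ℚ)
sgn-bounded false = ≤ᵇ⇒≤ _ , ≤ᵇ⇒≤ _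
sgn-bounded true = ≤ᵇ⇒≤ _ , ≤ᵇ⇒≤ _

χ-⊕ˡ : ∀ {n} (r γ x : F2 n) → χ r x * χ γ x ≡ χ (r ⊕ γ) x
χ-⊕ˡ r γ x = trans (sym (sgn-xor (dot r x) (dot γ x))) (cong sgn (sym (dot-⊕ˡ r γ x)))

χ-⊕ʳ : ∀ {n} (r x y : F2 n) → χ r (x ⊕ y) ≡ χ r x * χ r y
χ-⊕ʳ r x y = trans (cong sgn (dot-⊕ʳ r x y)) (sgn-xor (dot r x) (dot r y))

sumAll-cong : ∀ k {g h : F2 k → ℚ} → (∀ x → g x ≡ h x) → sumAll k g ≡ sumAll k h
sumAll-cong zero g≗h = g≗h []
sumAll-cong (suc k) g≗h =
  cong₂ _+_ (sumAll-cong k (λ x → g≗h (false ∷ x))) (sumAll-cong k (λ x → g≗h (true ∷ x)))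

sumAll-+ : ∀ k (g h : F2 k → ℚ) → sumAll k (λ x → g x + h x) ≡ sumAll k g + sumAll k h
sumAll-+ zero g h = refl
sumAll-+ (suc k) g h = trans (cong₂ _+_ (sumAll-+ k _ _) (sumAll-+ k _ _))
  (interchange⁺ (half g false) (half h false) (half g true) (half h true))
  where
  half : (F2 (suc k) → ℚ) → Bool → ℚ
  half f b = sumAll k (λ x → f (b ∷ x))
  interchange⁺ : ∀ a b c d → (a + b) + (c + d) ≡ (a + c) + (b + d)
  interchange⁺ = solve 4 (λ a b c d → (a :+ b) :+ (c :+ d) := (a :+ c) :+ (b :+ d)) refl

sumAll-* : ∀ k q (g : F2 k → ℚ) → sumAll k (λ x → q * g x) ≡ q * sumAll k g
sumAll-* zero q g = refl
sumAll-* (suc k) q g = trans (cong₂ _+_ (sumAll-* k q _) (sumAll-* k q _)) (sym (*-distribˡ-+ q _ _))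

sumAll-neg : ∀ k (g : F2 k → ℚ) → sumAll k (λ x → - g x) ≡ - sumAll k g
sumAll-neg zero g = refl
sumAll-neg (suc k) g = trans (cong₂ _+_ (sumAll-neg k _) (sumAll-neg k _))
  (sym (neg-distrib-+ (sumAll k (λ x → g (false ∷ x))) (sumAll k (λ x → g (true ∷ x)))))

avg-cong : ∀ k {g h : F2 k → ℚ} → (∀ x → g x ≡ h x) → avg k g ≡ avg k h
avg-cong k g≗h = cong (inv2^ k *_) (sumAll-cong k g≗h)

avg-+ : ∀ k (g h : F2 k → ℚ) → avg k (λ x → g x + h x) ≡ avg k g + avg k h
avg-+ k g h = trans (cong (inv2^ k *_) (sumAll-+ k g h)) (*-distribˡ-+ (inv2^ k) _ _)

avg-* : ∀ k q (g : F2 k → ℚ) → avg k (λ x → q * g x) ≡ q * avg k g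
avg-* k q g = trans (cong (inv2^ k *_) (sumAll-* k q g)) (swap (inv2^ k) q (sumAll k g))
  where
  swap : ∀ a b c → a * (b * c) ≡ b * (a * c)
  swap = solve 3 (λ a b c → a :* (b :* c) := b :* (a :* c)) refl

avg-const : ∀ k q → avg k (λ _ → q) ≡ q
avg-const zero q = *-identityˡ q
avg-const (suc k) q = trans (halve (inv2^ k) (sumAll k (λ _ → q))) (avg-const k q)
  where
  halve : ∀ a b → (ℚ.½ * a) * (b + b) ≡ a * b
  halve = solve 2 (λ a b → (con ℚ.½ :* a) :* (b :+ b) := a :* b) refl

sumAll-χ : ∀ {d} (w : F2 d) → w ≢ 0v d → sumAll d (χ w) ≡ 0ℚ
sumAll-χ [] w≢0 = ⊥-elim (w≢0 refl)
sumAll-χ {suc d} (false ∷ w) w≢0 =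
  cong₂ _+_ (sumAll-χ w (w≢0 ∘ cong (false ∷_))) (sumAll-χ w (w≢0 ∘ cong (false ∷_)))
sumAll-χ {suc d} (true ∷ w) _ = begin
  sumAll d (χ w) + sumAll d (λ c → sgn (not (dot w c)))  ≡⟨ cong (_+_ (sumAll d (χ w))) (sumAll-cong d (sgn-not ∘ dot w)) ⟩
  sumAll d (χ w) + sumAll d (λ c → - χ w c)              ≡⟨ cong (_+_ (sumAll d (χ w))) (sumAll-neg d (χ w)) ⟩
  sumAll d (χ w) + - sumAll d (χ w)                      ≡⟨ +-inverseʳ (sumAll d (χ w)) ⟩
  0ℚ                                                     ∎
  where open ≡-Reasoning

avg-χ : ∀ {d} (w : F2 d) → w ≢ 0v d → avg d (χ w) ≡ 0ℚ
avg-χ {d} w w≢0 = trans (cong (inv2^ d *_) (sumAll-χ w w≢0)) (*-zeroʳ (inv2^ d))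

avg-χ-0v : ∀ d → avg d (χ (0v d)) ≡ 1ℚ
avg-χ-0v d = trans (avg-cong d (cong sgn ∘ dot-0vˡ)) (avg-const d 1ℚ)

-- Walsh polynomials Σ q χ_r, given by their list of terms (r , q)

walsh : ∀ {n} → List (F2 n × ℚ) → F2 n → ℚ
walsh [] x = 0ℚ
walsh ((r , q) ∷ Q) x = q * χ r x + walsh Q x

coeff : ∀ {n} → List (F2 n × ℚ) → F2 n → ℚ
coeff [] γ = 0ℚ
coeff ((r , q) ∷ Q) γ with r ≟v γ
... | yes _ = q + coeff Q γ
... | no _ = coeff Q γ

coeff-here : ∀ {n} γ q (Q : List (F2 n × ℚ)) → coeff ((γ , q) ∷ Q) γ ≡ q + coeff Q γ
coeff-here γ q Q with γ ≟v γ
... | yes _ = refl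
... | no γ≢γ = ⊥-elim (γ≢γ refl)

coeff-∉ : ∀ {n} (Q : List (F2 n × ℚ)) {γ} → γ ∉ List.map proj₁ Q → coeff Q γ ≡ 0ℚ
coeff-∉ [] _ = refl
coeff-∉ ((r , q) ∷ Q) {γ} γ∉ with r ≟v γ
... | yes refl = ⊥-elim (γ∉ (here refl))
... | no _ = coeff-∉ Q (γ∉ ∘ there)

fourier-walsh : ∀ {n} (Q : List (F2 n × ℚ)) γ → fourier (walsh Q) γ ≡ coeff Q γ
fourier-walsh {n} [] γ = trans (avg-cong n (λ x → *-zeroˡ (χ γ x))) (avg-const n 0ℚ)
fourier-walsh {n} ((r , q) ∷ Q) γ = begin
  avg n (λ x → (q * χ r x + walsh Q x) * χ γ x)          ≡⟨ avg-cong n expand ⟩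
  avg n (λ x → q * χ (r ⊕ γ) x + walsh Q x * χ γ x)      ≡⟨ avg-+ n _ _ ⟩
  avg n (λ x → q * χ (r ⊕ γ) x) + fourier (walsh Q) γ    ≡⟨ cong₂ _+_ (avg-* n q (χ (r ⊕ γ))) (fourier-walsh Q γ) ⟩
  q * avg n (χ (r ⊕ γ)) + coeff Q γ                      ≡⟨ orthogonality ⟩
  coeff ((r , q) ∷ Q) γ                                  ∎
  where
  open ≡-Reasoning
  expand : ∀ x → (q * χ r x + walsh Q x) * χ γ x ≡ q * χ (r ⊕ γ) x + walsh Q x * χ γ x
  expand x = trans (*-distribʳ-+ (χ γ x) (q * χ r x) (walsh Q x))
    (cong (_+ walsh Q x * χ γ x) (trans (*-assoc q (χ r x) (χ γ x)) (cong (q *_) (χ-⊕ˡ r γ x))))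
  orthogonality : q * avg n (χ (r ⊕ γ)) + coeff Q γ ≡ coeff ((r , q) ∷ Q) γ
  orthogonality with r ≟v γ
  ... | yes refl = cong (_+ coeff Q r)
    (trans (cong (λ w → q * avg n (χ w)) (⊕-self r)) (trans (cong (q *_) (avg-χ-0v n)) (*-identityʳ q)))
  ... | no r≢γ = trans (cong (λ a → q * a + coeff Q γ) (avg-χ (r ⊕ γ) (r≢γ ∘ ⊕≡0v⇒≡ r γ)))
    (trans (cong (_+ coeff Q γ) (*-zeroʳ q)) (+-identityˡ (coeff Q γ)))

restrictTerms : ∀ {n d} → Vec (F2 n) d → F2 n → List (F2 n × ℚ) → List (F2 d × ℚ)
restrictTerms B α = List.map λ (r , q) → pullback B r , q * χ r α

walsh-restrict : ∀ {n d} (B : Vec (F2 n) d) α Q c →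
  walsh Q (linComb B c ⊕ α) ≡ walsh (restrictTerms B α Q) c
walsh-restrict B α [] c = refl
walsh-restrict B α ((r , q) ∷ Q) c = cong₂ _+_ term (walsh-restrict B α Q c)
  where
  open ≡-Reasoning
  rearrange : ∀ a b c → a * (b * c) ≡ (a * c) * b
  rearrange = solve 3 (λ a b c → a :* (b :* c) := (a :* c) :* b) refl
  term : q * χ r (linComb B c ⊕ α) ≡ (q * χ r α) * χ (pullback B r) c
  term = begin
    q * χ r (linComb B c ⊕ α)            ≡⟨ cong (q *_) (χ-⊕ʳ r (linComb B c) α) ⟩
    q * (χ r (linComb B c) * χ r α)      ≡⟨ cong (λ s → q * (sgn s * χ r α)) (dot-linComb B r c) ⟩
    q * (χ (pullback B r) c * χ r α)     ≡⟨ rearrange q (χ (pullback B r) c) (χ r α) ⟩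
    (q * χ r α) * χ (pullback B r) c     ∎

restrCoeff-walsh : ∀ {n} (Q : List (F2 n × ℚ)) (U : AffineSubspace n) γ →
  restrCoeff (walsh Q) U γ ≡ coeff (restrictTerms (basis U) (offset U) Q) (pullback (basis U) γ)
restrCoeff-walsh Q U γ = trans
  (avg-cong (dim U) λ c →
    cong₂ _*_ (walsh-restrict (basis U) (offset U) Q c) (cong sgn (dot-linComb (basis U) γ c)))
  (fourier-walsh (restrictTerms (basis U) (offset U) Q) (pullback (basis U) γ))

module OccurrencesF2 {n : ℕ} = Occurrences (_≟v_ {n})
open OccurrencesF2 using (count; count≡0⇒∉; NoSingletonsExcept; HalfCover; halfCover)

coeff-singleton : ∀ {n} (Q : List (F2 n × ℚ)) γ → count γ (List.map proj₁ Q) ≡ 1 →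
  ∃ λ q → (γ , q) ∈ Q × coeff Q γ ≡ q
coeff-singleton ((r , q) ∷ Q) γ once with r ≟v γ
... | yes refl = q , here refl ,
  trans (cong (_+_ q) (coeff-∉ Q (count≡0⇒∉ r _ (suc-injective once)))) (+-identityʳ q)
... | no _ with coeff-singleton Q γ once
...   | q′ , mem , eq = q′ , there mem , eq

signTerms : (n : ℕ) → .{{NonZero n}} → List (F2 n × ℚ)
signTerms n = List.map (_, (+ 1) / n) (unitVectors n)

meanSign : (n : ℕ) → .{{NonZero n}} → F2 n → ℚ
meanSign n = walsh (signTerms n)

map-proj₁-, : ∀ {A B : Set} (b : B) (xs : List A) → List.map proj₁ (List.map (_, b) xs) ≡ xs
map-proj₁-, b xs = trans (sym (map-∘ xs)) (map-id xs)

fromℤ-suc : ∀ k → fromℤ (+ suc k) ≡ 1ℚ + fromℤ (+ k)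
fromℤ-suc k =
  sym (trans (/-cong {q₂ = 1} (cong (ℤ._+_ (+ 1)) (ℤₚ.*-identityʳ (+ k))) refl) (↥p/↧p≡p (fromℤ (+ suc k))))

1/n*n≡1 : ∀ n → .{{_ : NonZero n}} → (+ 1) / n * fromℤ (+ n) ≡ 1ℚ
1/n*n≡1 (suc m) =
  trans (cong (_* fromℤ (+ suc m)) (↥p/↧p≡p (1/ fromℤ (+ suc m)))) (*-inverseˡ (fromℤ (+ suc m)))

walsh-uniform-bounded : ∀ {n} q → .{{NonNegative q}} → (es : List (F2 n)) → ∀ x →
  let b = q * fromℤ (+ length es) ; w = walsh (List.map (_, q) es) x in (- b ℚ.≤ w) × (w ℚ.≤ b)
walsh-uniform-bounded q [] x = ℚₚ.≤-reflexive (cong -_ (*-zeroʳ q)) , ℚₚ.≤-reflexive (sym (*-zeroʳ q))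
walsh-uniform-bounded q (e ∷ es) x = lower , upper
  where
  open ℚₚ.≤-Reasoning
  N : ℚ
  N = fromℤ (+ length es)
  w : ℚ
  w = walsh (List.map (_, q) es) x
  rest : (- (q * N) ℚ.≤ w) × (w ℚ.≤ q * N)
  rest = walsh-uniform-bounded q es x
  split : q * 1ℚ + q * N ≡ q * fromℤ (+ suc (length es))
  split = trans (sym (*-distribˡ-+ q 1ℚ N)) (cong (q *_) (sym (fromℤ-suc (length es))))
  upper : q * χ e x + w ℚ.≤ q * fromℤ (+ suc (length es))
  upper = begin
    q * χ e x + w                      ≤⟨ +-mono-≤ (*-monoˡ-≤-nonNeg q (proj₂ (sgn-bounded (dot e x)))) (proj₂ rest) ⟩
    q * 1ℚ + q * N                     ≡⟨ split ⟩
    q * fromℤ (+ suc (length es))      ∎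
  lower : - (q * fromℤ (+ suc (length es))) ℚ.≤ q * χ e x + w
  lower = begin
    - (q * fromℤ (+ suc (length es)))  ≡⟨ cong -_ (sym split) ⟩
    - (q * 1ℚ + q * N)                 ≡⟨ neg-distrib-+ (q * 1ℚ) (q * N) ⟩
    - (q * 1ℚ) + - (q * N)             ≡⟨ cong (_+ - (q * N)) (neg-distribʳ-* q 1ℚ) ⟩
    q * - 1ℚ + - (q * N)               ≤⟨ +-mono-≤ (*-monoˡ-≤-nonNeg q (proj₁ (sgn-bounded (dot e x)))) (proj₁ rest) ⟩
    q * χ e x + w                      ∎

meanSign-bounded : ∀ n → .{{_ : NonZero n}} → ∀ x → (- 1ℚ ℚ.≤ meanSign n x) × (meanSign n x ℚ.≤ 1ℚ)
meanSign-bounded n x =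
  subst (ℚ._≤ meanSign n x) (cong -_ q*n≡1) (proj₁ bounds) , subst (meanSign n x ℚ.≤_) q*n≡1 (proj₂ bounds)
  where
  b : ℚ
  b = (+ 1) / n * fromℤ (+ length (unitVectors n))
  bounds : (- b ℚ.≤ meanSign n x) × (meanSign n x ℚ.≤ b)
  bounds = walsh-uniform-bounded ((+ 1) / n) {{normalize-nonNeg 1 n}} (unitVectors n) x
  q*n≡1 : b ≡ 1ℚ
  q*n≡1 = trans (cong (λ k → (+ 1) / n * fromℤ (+ k)) (length-unitVectors n)) (1/n*n≡1 n)

meanSign-degree : ∀ n → .{{_ : NonZero n}} → HasFourierDegree (meanSign n) 1
meanSign-degree (suc m) = spectrum , e₁ , f̂e₁≢0 , cong suc (weight-0v m)
  where
  n = suc m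
  q = (+ 1) / n
  e₁ = true ∷ 0v m
  spectrum : ∀ γ → fourier (meanSign n) γ ≢ 0ℚ → weight γ ≤ 1
  spectrum γ f̂γ≢0 with weight γ ℕ.≟ 1
  ... | yes w≡1 = ≤-reflexive w≡1
  ... | no w≢1 = ⊥-elim (f̂γ≢0 (trans (fourier-walsh (signTerms n) γ) (coeff-∉ (signTerms n) γ∉)))
    where
    γ∉ : γ ∉ List.map proj₁ (signTerms n)
    γ∉ γ∈ = w≢1 (weight-unitVectors (subst (γ ∈_) (map-proj₁-, q (unitVectors n)) γ∈))
  e₁∉ : e₁ ∉ List.map proj₁ (List.map (_, q) (List.map (false ∷_) (unitVectors m)))
  e₁∉ e₁∈ with ∈-map⁻ (false ∷_) (subst (e₁ ∈_) (map-proj₁-, q _) e₁∈)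
  ... | _ , _ , ()
  f̂e₁≢0 : fourier (meanSign n) e₁ ≢ 0ℚ
  f̂e₁≢0 = subst (_≢ 0ℚ) (sym f̂e₁≡q) (≢-sym (<⇒≢ (positive⁻¹ q {{normalize-pos 1 n}})))
    where
    f̂e₁≡q : fourier (meanSign n) e₁ ≡ q
    f̂e₁≡q = trans (fourier-walsh (signTerms n) e₁)
      (trans (coeff-here e₁ q _) (trans (cong (_+_ q) (coeff-∉ _ e₁∉)) (+-identityʳ q)))

restrictedSignTerms : (n : ℕ) → .{{NonZero n}} → (U : AffineSubspace n) → List (F2 (dim U) × ℚ)
restrictedSignTerms n U = List.map (λ e → pullback (basis U) e , (+ 1) / n * χ e (offset U)) (unitVectors n)

restrCoeff-meanSign : ∀ n → .{{_ : NonZero n}} → ∀ (U : AffineSubspace n) γ →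
  restrCoeff (meanSign n) U γ ≡ coeff (restrictedSignTerms n U) (pullback (basis U) γ)
restrCoeff-meanSign n U γ = trans (restrCoeff-walsh (signTerms n) U γ)
  (cong (λ T → coeff T (pullback (basis U) γ)) (sym (map-∘ (unitVectors n))))

singletonRow⇒irregular : ∀ n → .{{_ : NonZero n}} → ∀ (U : AffineSubspace n) {v} → v ≢ 0v (dim U) →
  count v (List.map proj₁ (restrictedSignTerms n U)) ≡ 1 →
  ∃ λ γ → ¬ InPerp U γ × ∣ restrCoeff (meanSign n) U γ ∣ ≡ (+ 1) / n
singletonRow⇒irregular n U {v} v≢0 once with coeff-singleton (restrictedSignTerms n U) v once
... | _ , mem , coeff≡ with ∈-map⁻ _ mem
... | e , _ , refl = e , pullback≢0v⇒¬InPerp U e v≢0 , (begin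
  ∣ restrCoeff (meanSign n) U e ∣            ≡⟨ cong ∣_∣ (trans (restrCoeff-meanSign n U e) coeff≡) ⟩
  ∣ (+ 1) / n * χ e (offset U) ∣             ≡⟨ ∣p*q∣≡∣p∣*∣q∣ ((+ 1) / n) (χ e (offset U)) ⟩
  ∣ (+ 1) / n ∣ * ∣ χ e (offset U) ∣          ≡⟨ cong₂ _*_ ∣1/n∣≡1/n (∣sgn∣ (dot e (offset U))) ⟩
  (+ 1) / n * 1ℚ                             ≡⟨ *-identityʳ _ ⟩
  (+ 1) / n                                  ∎)
  where
  open ≡-Reasoning
  ∣1/n∣≡1/n : ∣ (+ 1) / n ∣ ≡ (+ 1) / n
  ∣1/n∣≡1/n = 0≤p⇒∣p∣≡p (nonNegative⁻¹ ((+ 1) / n) {{normalize-nonNeg 1 n}})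

regular⇒noSingletonRows : ∀ n → .{{_ : NonZero n}} → ∀ δ → δ ℚ.< (+ 1) / n →
  ∀ U → IsRegular (meanSign n) U δ → NoSingletonsExcept (0v (dim U)) (List.map proj₁ (restrictedSignTerms n U))
regular⇒noSingletonRows n δ δ<1/n U regular v once with v ≟v 0v (dim U)
... | yes v≡0 = v≡0
... | no v≢0 with singletonRow⇒irregular n U v≢0 once
... | γ , γ∉⊥ , ∣f̂∣≡1/n =
  ⊥-elim (<-irrefl refl (≤-<-trans (subst (ℚ._≤ δ) ∣f̂∣≡1/n (regular γ γ∉⊥)) δ<1/n))

2*d≤n⇒n≤2*[n∸d] : ∀ {d n} → 2 ℕ.* d ≤ n → n ≤ 2 ℕ.* (n ∸ d)
2*d≤n⇒n≤2*[n∸d] {d} {n} 2d≤n = begin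
  n                          ≤⟨ m≤n+m∸n n d ⟩
  d ℕ.+ (n ∸ d)              ≤⟨ +-monoˡ-≤ (n ∸ d) (m+n≤o⇒m≤o∸n d d+d≤n) ⟩
  (n ∸ d) ℕ.+ (n ∸ d)        ≡⟨ cong ((n ∸ d) ℕ.+_) (sym (+-identityʳℕ (n ∸ d))) ⟩
  2 ℕ.* (n ∸ d)              ∎
  where
  open ≤-Reasoning
  d+d≤n : d ℕ.+ d ≤ n
  d+d≤n = subst (_≤ n) (cong (d ℕ.+_) (+-identityʳℕ d)) 2d≤n

meanSign-regular : ∀ n → .{{_ : NonZero n}} → ∀ δ → δ ℚ.< (+ 1) / n → RegCodimAtLeastHalf n (meanSign n) δ
meanSign-regular n δ δ<1/n U regular = 2*d≤n⇒n≤2*[n∸d] {dim U} (begin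
  2 ℕ.* dim U         ≤⟨ *-monoʳ-≤ 2 (dim≤length elems orthogonal⇒0) ⟩
  2 ℕ.* length elems  ≤⟨ small ⟩
  length rows         ≡⟨ length-rows ⟩
  n                   ∎)
  where
  open ≤-Reasoning
  rows : List (F2 (dim U))
  rows = List.map proj₁ (restrictedSignTerms n U)
  length-rows : length rows ≡ n
  length-rows = trans (length-map proj₁ (restrictedSignTerms n U))
    (trans (length-map _ (unitVectors n)) (length-unitVectors n))
  open HalfCover (halfCover rows (regular⇒noSingletonRows n δ δ<1/n U regular))
  orthogonal⇒0 : ∀ c → (∀ {w} → w ∈ elems → dot w c ≡ false) → c ≡ 0v (dim U)
  orthogonal⇒0 c elems⊥c = LinIndep⇒rows-separate {B = basis U} (indep U) c λ e∈ →
    [ (λ w≡0 → trans (cong (λ w → dot w c) w≡0) (dot-0vˡ c)) , elems⊥c ]′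
      (covers (∈-map⁺ proj₁ (∈-map⁺ _ e∈)))

lemma4p2 : (n : ℕ) → .{{_ : NonZero n}} →
    Σ (F2 n → ℚ) λ f →
      (∀ x → ((- 1ℚ) ℚ.≤ f x) × (f x ℚ.≤ 1ℚ))
      × HasFourierDegree f 1
      × (∀ (δ : ℚ) → δ ℚ.< (+ 1) / n → RegCodimAtLeastHalf n f δ)
lemma4p2 n = meanSign n , meanSign-bounded n , meanSign-degree n , meanSign-regular n
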